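{- Let $n\ge 4$ and $1\le c<n$. Every transversal $T$ of the family $\mathcal{F}_c=\{F_{i,c,j}:1\le i\le c<j\le n\}$ is minimally inversion-complete.
   Context: $S_n$ is the set of permutations of $[n]$, written as sequences $(\pi(1),\dots,\pi(n))$; $\pi$ covers the ordered pair $(\pi(k),\pi(l))$ iff $k<l$. An inversion is a pair $(j,i)$ with $1\le i<j\le n$. $Q\subseteq S_n$ is inversion-complete if every inversion is covered by some element of $Q$, and minimally inversion-complete if no proper subset of $Q$ is inversion-complete. For integers $1\le i\le c<j\le n$, $F_{i,c,j}$ is the set of all $\pi\in S_n$ such that $\pi(h)\le c$ for all $h<c$, $\pi(c)=j$, $\pi(c+1)=i$, and $\pi(k)\ge c+1$ for all $k>c+1$. A transversal of a collection of sets is a set containing exactly one element from each member. -}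

module Defs where

open import Data.Nat using (ℕ; suc; _≤_; _<_; _≥_)
open import Data.Fin using (Fin; toℕ)
open import Data.Fin.Permutation using (Permutation′; _⟨$⟩ʳ_)
open import Data.Product using (Σ; ∃; _×_; _,_)
open import Relation.Binary.PropositionalEquality using (_≡_)

-- S_n : permutations of [n].  Positions and values are 1-based:
-- position k : Fin n stands for (toℕ k + 1), and the value π(toℕ k + 1)
-- is toℕ (π ⟨$⟩ʳ k) + 1.
Perm : ℕ → Set
Perm n = Permutation′ n

pos : {n : ℕ} → Fin n → ℕ
pos k = suc (toℕ k)

val : {n : ℕ} → Perm n → Fin n → ℕ
val π k = suc (toℕ (π ⟨$⟩ʳ k))

Covers : {n : ℕ} → Perm n → ℕ → ℕ → Set
Covers {n} π a b = Σ (Fin n) λ k → Σ (Fin n) λ l →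
  pos k < pos l × val π k ≡ a × val π l ≡ b

PermSet : ℕ → Set₁
PermSet n = Perm n → Set

InversionComplete : {n : ℕ} → PermSet n → Set
InversionComplete {n} Q = ∀ (i j : ℕ) → 1 ≤ i → i < j → j ≤ n →
  Σ (Perm n) λ π → Q π × Covers π j i

-- no proper subset of Q is inversion-complete:
-- every inversion-complete Q' ⊆ Q already contains all of Q
MinimallyInversionComplete : {n : ℕ} → PermSet n → Set₁
MinimallyInversionComplete {n} Q =
  InversionComplete Q ×
  (∀ (Q' : PermSet n) → (∀ π → Q' π → Q π) → InversionComplete Q' →
     ∀ π → Q π → Q' π)

F : (n i c j : ℕ) → PermSet n
F n i c j π =
  (∀ (h : Fin n) → pos h < c → val π h ≤ c) ×
  (∀ (h : Fin n) → pos h ≡ c → val π h ≡ j) ×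
  (∀ (h : Fin n) → pos h ≡ suc c → val π h ≡ i) ×
  (∀ (k : Fin n) → pos k > suc c → val π k ≥ suc c)
  where open Data.Nat using (_>_)

ValidIndex : (n c i j : ℕ) → Set
ValidIndex n c i j = 1 ≤ i × i ≤ c × c < j × j ≤ n

Transversal : (n c : ℕ) → PermSet n → Set
Transversal n c T =
  (∀ (i j : ℕ) → ValidIndex n c i j →
     Σ (Perm n) λ π → T π × F n i c j π ×
       (∀ (π' : Perm n) → T π' → F n i c j π' → π' ≡ π)) ×
  (∀ (π : Perm n) → T π →
     Σ ℕ λ i → Σ ℕ λ j → ValidIndex n c i j × F n i c j π)

-- In a member of F_{i,c,j} the values ≤ c occupy positions ≤ c+1 and the values > c
-- occupy positions ≥ c, with j at position c and i at position c+1.  Hence such a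
-- permutation covers the crossing inversion (j , i), i ≤ c < j, and no other crossing
-- inversion, while every inversion is covered by all members of a suitable F_{i,c,j}.
-- So a transversal T is inversion-complete, and an inversion-complete Q ⊆ T must, for
-- each π ∈ T ∩ F_{i,c,j}, contain a permutation covering (j , i); it lies in T ∩ F_{i,c,j}
-- and is therefore π itself.
module Submission where

open import Defs
open import Data.Nat using (ℕ; suc; _≤_; _<_; _≤?_; s≤s; z≤n)
open import Data.Nat.Properties
  using (≤-refl; ≤-trans; <-trans; <-≤-trans; ≤-<-trans; <⇒≤; <⇒≱; ≮⇒≥; ≰⇒>; ≤∧≢⇒<; ≤-antisym; ≤-pred; <⇒≢)
open import Data.Fin using (Fin; toℕ; fromℕ<)
open import Data.Fin.Properties using (toℕ-fromℕ<)
open import Data.Fin.Permutation using (_⟨$⟩ˡ_; inverseʳ)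
open import Data.Product using (Σ; _×_; _,_; proj₁; proj₂)
open import Relation.Binary.PropositionalEquality
  using (_≡_; _≢_; refl; sym; trans; cong; subst; subst₂; ≢-sym)
open import Relation.Nullary using (yes; no)

pos-surjective : ∀ {n} m → 1 ≤ m → m ≤ n → Σ (Fin n) λ k → pos k ≡ m
pos-surjective (suc m) _ m<n = fromℕ< m<n , cong suc (toℕ-fromℕ< m<n)

val-surjective : ∀ {n} (π : Perm n) x → 1 ≤ x → x ≤ n → Σ (Fin n) λ k → val π k ≡ x
val-surjective π (suc x) _ x<n =
  π ⟨$⟩ˡ fromℕ< x<n , trans (cong (λ y → suc (toℕ y)) (inverseʳ π)) (cong suc (toℕ-fromℕ< x<n))

module _ {n c : ℕ} (i j : ℕ) (π : Perm n) (Fπ : F n i c j π) where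

  private
    below : ∀ h → pos h < c → val π h ≤ c
    below = proj₁ Fπ
    at-c : ∀ h → pos h ≡ c → val π h ≡ j
    at-c = proj₁ (proj₂ Fπ)
    at-1+c : ∀ h → pos h ≡ suc c → val π h ≡ i
    at-1+c = proj₁ (proj₂ (proj₂ Fπ))
    above : ∀ h → suc c < pos h → suc c ≤ val π h
    above = proj₂ (proj₂ (proj₂ Fπ))

  F-large⇒c≤pos : ∀ k → c < val π k → c ≤ pos k
  F-large⇒c≤pos k c<v = ≮⇒≥ λ pk<c → <⇒≱ c<v (below k pk<c)

  F-small⇒pos≤1+c : ∀ k → val π k ≤ c → pos k ≤ suc c
  F-small⇒pos≤1+c k v≤c = ≮⇒≥ λ 1+c<pk → <⇒≱ (above k 1+c<pk) v≤c

  F-covers-crossing : 1 ≤ c → c < n → Covers π j i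
  F-covers-crossing 1≤c c<n with pos-surjective c 1≤c (<⇒≤ c<n) | pos-surjective (suc c) (s≤s z≤n) c<n
  ... | k , pk≡c | l , pl≡1+c =
    k , l , subst₂ _<_ (sym pk≡c) (sym pl≡1+c) ≤-refl , at-c k pk≡c , at-1+c l pl≡1+c

  F-covers-from-top : 1 ≤ c → c < n → ∀ x → c < x → x ≢ j → x ≤ n → Covers π j x
  F-covers-from-top 1≤c c<n x c<x x≢j x≤n
    with pos-surjective c 1≤c (<⇒≤ c<n) | val-surjective π x (≤-trans 1≤c (<⇒≤ c<x)) x≤n
  ... | k , pk≡c | l , vl≡x = k , l , subst (_< pos l) (sym pk≡c) c<pl , at-c k pk≡c , vl≡x
    where
    c<pl : c < pos l
    c<pl = ≤∧≢⇒< (F-large⇒c≤pos l (subst (c <_) (sym vl≡x) c<x))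
                 λ c≡pl → x≢j (trans (sym vl≡x) (at-c l (sym c≡pl)))

  F-covers-to-bottom : c < n → ∀ x → 1 ≤ x → x ≤ c → x ≢ i → Covers π x i
  F-covers-to-bottom c<n x 1≤x x≤c x≢i
    with val-surjective π x 1≤x (≤-trans x≤c (<⇒≤ c<n)) | pos-surjective (suc c) (s≤s z≤n) c<n
  ... | k , vk≡x | l , pl≡1+c = k , l , subst (pos k <_) (sym pl≡1+c) pk<1+c , vk≡x , at-1+c l pl≡1+c
    where
    pk<1+c : pos k < suc c
    pk<1+c = ≤∧≢⇒< (F-small⇒pos≤1+c k (subst (_≤ c) (sym vk≡x) x≤c))
                   λ pk≡1+c → x≢i (trans (sym vk≡x) (at-1+c k pk≡1+c))

  -- c ≤ pos k < pos l ≤ c+1 pins the covering positions to c and c+1.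
  F-covers-crossing-only : ∀ {a b} → a ≤ c → c < b → Covers π b a → a ≡ i × b ≡ j
  F-covers-crossing-only a≤c c<b (k , l , pk<pl , vk≡b , vl≡a) =
    trans (sym vl≡a) (at-1+c l pl≡1+c) , trans (sym vk≡b) (at-c k pk≡c)
    where
    c≤pk : c ≤ pos k
    c≤pk = F-large⇒c≤pos k (subst (c <_) (sym vk≡b) c<b)
    pl≤1+c : pos l ≤ suc c
    pl≤1+c = F-small⇒pos≤1+c l (subst (_≤ c) (sym vl≡a) a≤c)
    pk≡c : pos k ≡ c
    pk≡c = ≤-antisym (≤-pred (<-≤-trans pk<pl pl≤1+c)) c≤pk
    pl≡1+c : pos l ≡ suc c
    pl≡1+c = ≤-antisym pl≤1+c (≤-trans (s≤s c≤pk) pk<pl)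

F-covers-inversion : ∀ {n c a b} → 1 ≤ c → c < n → 1 ≤ a → a < b → b ≤ n →
  Σ ℕ λ i → Σ ℕ λ j → ValidIndex n c i j × (∀ π → F n i c j π → Covers π b a)
F-covers-inversion {c = c} {a} {b} 1≤c c<n 1≤a a<b b≤n with a ≤? c | b ≤? c
... | yes a≤c | no b≰c =
  a , b , (1≤a , a≤c , ≰⇒> b≰c , b≤n) , λ π Fπ → F-covers-crossing a b π Fπ 1≤c c<n
... | yes a≤c | yes b≤c =
  a , suc c , (1≤a , a≤c , ≤-refl , c<n) ,
  λ π Fπ → F-covers-to-bottom a (suc c) π Fπ c<n b (≤-trans 1≤a (<⇒≤ a<b)) b≤c (≢-sym (<⇒≢ a<b))
... | no a≰c | _ =
  1 , b , (≤-refl , 1≤c , <-trans (≰⇒> a≰c) a<b , b≤n) ,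
  λ π Fπ → F-covers-from-top 1 b π Fπ 1≤c c<n a (≰⇒> a≰c) (<⇒≢ a<b) (≤-trans (<⇒≤ a<b) b≤n)

transversal-inversionComplete : ∀ {n c} → 1 ≤ c → c < n →
  (T : PermSet n) → Transversal n c T → InversionComplete T
transversal-inversionComplete 1≤c c<n T (member , _) a b 1≤a a<b b≤n
  with F-covers-inversion 1≤c c<n 1≤a a<b b≤n
... | i , j , valid , covers with member i j valid
...   | π , Tπ , Fπ , _ = π , Tπ , covers π Fπ

transversal-minimal : ∀ {n c} (T : PermSet n) → Transversal n c T →
  ∀ (Q : PermSet n) → (∀ π → Q π → T π) → InversionComplete Q → ∀ π → T π → Q π
transversal-minimal T (member , inFamily) Q Q⊆T completeQ π Tπ
  with inFamily π Tπ
... | i , j , valid@(1≤i , i≤c , c<j , j≤n) , Fπ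
  with completeQ i j 1≤i (≤-<-trans i≤c c<j) j≤n
...   | σ , Qσ , σ-covers with inFamily σ (Q⊆T σ Qσ)
...     | i′ , j′ , _ , Fσ with F-covers-crossing-only i′ j′ σ Fσ i≤c c<j σ-covers
...       | refl , refl = subst Q (trans (unique σ (Q⊆T σ Qσ) Fσ) (sym (unique π Tπ Fπ))) Qσ
  where
  unique = proj₂ (proj₂ (proj₂ (member i j valid)))

lemma5 : (n c : ℕ) → 4 ≤ n → 1 ≤ c → c < n →
    (T : PermSet n) → Transversal n c T → MinimallyInversionComplete T
lemma5 n c _ 1≤c c<n T transversal =
  transversal-inversionComplete 1≤c c<n T transversal ,
  transversal-minimal T transversal
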